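{- Let $\Delta^n=(\mathrm{Prop}_k,\mathrm{Nom}_k)_{k\in\{0,\dots,n\}}$ be a signature, let $M=(W^n,D^n,R^n,V^n)$ be an $n$-layered model over $\Delta^n$, let $k\in\{0,\dots,n\}$ and let $\varphi\in Fm_k(\Delta^n)$. Then for every $(w_0,\dots,w_k)\in D_k$, \[M_k,w_0,\dots,w_k\models_k\varphi \quad\text{iff}\quad \overline{M_k}\models \mathrm{ST}^k_{x_0,\dots,x_k}(\varphi),\] where $x_0,\dots,x_k$ are distinct variables of sorts $S_0,\dots,S_k$, $\overline{M_k}$ denotes the first-order structure $M^*_k$ together with the assignment $x_r\mapsto w_r$ ($r\in\{0,\dots,k\}$), and $\models$ on the right is ordinary many-sorted first-order satisfaction.
   Context: Notation. For $P\subseteq S_0\times\dots\times S_n$ and $k\le n$, $P|_k\subseteq S_0\times\dots\times S_k$ is the set of $(s_0,\dots,s_k)$ such that $(s_0,\dots,s_n)\in P$ for some $s_{k+1},\dots,s_n$. Signatures. An $n$-layered signature $\Delta^n=(\mathrm{Prop}_k,\mathrm{Nom}_k)_{k\in\{0,\dots,n\}}$ is a family of pairwise disjoint, possibly empty, sets; elements $p_k\in\mathrm{Prop}_k$ are propositions of level $k$, elements $i_k\in\mathrm{Nom}_k$ are nominals of level $k$. Formulas. Define simultaneously, for $k\in\{0,\dots,n\}$, the set $Fm_k(\Delta^n)$ of level-$k$ formulas and the set $B_k$ of basic level-$k$ formulas: - $Fm_0$: $i_0\mid p_0\mid\neg\varphi\mid\varphi\wedge\psi\mid @_{i_0}\varphi\mid\Diamond_0\varphi$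 (with $\varphi,\psi\in Fm_0$); $B_0$: $i_0\mid p_0\mid @_{i_0}\varphi\mid \Diamond_0\varphi$ with $\varphi\in Fm_0$. - For $k\ge1$, $Fm_k$: $\beta\mid i_k\mid p_k\mid\neg\varphi\mid\varphi\wedge\psi\mid @_{i_k}\varphi\mid\Diamond_k\varphi$ with $\beta\in B_{k-1}$ and $\varphi,\psi\in Fm_k$; and $B_k$: $i_k\mid p_k\mid\beta\mid @_{i_k}\varphi\mid\Diamond_k\varphi$ with $\beta\in B_{k-1}$, $\varphi\in Fm_k$. Here $i_k\in\mathrm{Nom}_k$, $p_k\in\mathrm{Prop}_k$. Models. An $n$-layered model $M=(W^n,D^n,R^n,V^n)$ over $\Delta^n$ consists of: a family $W^n=(W_k)_{k\le n}$ of pairwise disjoint sets; a predicate $D^n\subseteq W_0\times\dots\times W_n$ such that, writing $D_k=D^n|_k$, for each $k$, $W_k=\{v_k\mid (w_0,\dots,w_{k-1},v_k)\in D_k \text{ for some } (w_0,\dots,w_{k-1})\in D_{k-1}\}$; relations $R_k\subseteq D_k\times D_k$ for $k\le n$; and valuations $V^{\mathrm{Prop}}_0:\mathrm{Prop}_0\to\mathcal P(W_0)$, $V^{\mathrm{Prop}}_k:\mathrm{Prop}_k\times D_{k-1}\to\mathcal P(W_k)$ for $k\ge1$, and $V^{\mathrm{Nom}}_k:\mathrm{Nom}_k\to W_k$. The $k$-restriction $M_k$ keeps only the components of levels $\le k$ (with $D_k$ in place of $D^n$). Satisfaction. For $(w_0,\dots,w_k)\in D_k$ and $\varphi\in Fm_k$,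 $M_k,w_0,\dots,w_k\models_k\varphi$ is defined by: - $\beta\in B_{k-1}$ ($k\ge1$): iff $M_{k-1},w_0,\dots,w_{k-1}\models_{k-1}\beta$; - $p_k$: iff $w_0\in V^{\mathrm{Prop}}_0(p_0)$ when $k=0$, and iff $w_k\in V^{\mathrm{Prop}}_k(p_k,(w_0,\dots,w_{k-1}))$ when $k\ge1$; - $i_k$: iff $w_k=V^{\mathrm{Nom}}_k(i_k)$ and $(w_0,\dots,w_{k-1},V^{\mathrm{Nom}}_k(i_k))\in D_k$; - $\neg$, $\wedge$: as usual; - $@_{i_k}\varphi$: iff $(w_0,\dots,w_{k-1},V^{\mathrm{Nom}}_k(i_k))\in D_k$ and $M_k,w_0,\dots,w_{k-1},V^{\mathrm{Nom}}_k(i_k)\models_k\varphi$; - $\Diamond_k\varphi$: iff there is $(v_0,\dots,v_k)$ with $(w_0,\dots,w_k)R_k(v_0,\dots,v_k)$ and $M_k,v_0,\dots,v_k\models_k\varphi$. First-order translation. For $k\le n$, the many-sorted first-order signature $\Sigma^k$ has sorts $S_0,\dots,S_k$; for each $r\le k$ a constant $i_r$ of sort $S_r$ for each $i_r\in\mathrm{Nom}_r$, a predicate symbol $D_r$ of arity $S_0\cdots S_r$, a predicate symbol $p_r$ of arity $S_0\cdots S_r$ for each $p_r\in\mathrm{Prop}_r$, and a predicate symbol $R_r$ of arity $S_0\cdots S_rS_0\cdots S_r$. The $\Sigma^k$-structure $M^*_k$ interprets $S_r$ as $W_r$, $i_r$ as $V^{\mathrm{Nom}}_r(i_r)$, $D_r$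 as $D_r$, $R_r$ as $R_r$, $p_0$ as $V^{\mathrm{Prop}}_0(p_0)$, and for $r\ge1$, $p_r$ as $\{(w_0,\dots,w_r)\mid (w_0,\dots,w_{r-1})\in D_{r-1},\ w_r\in V^{\mathrm{Prop}}_r(p_r,(w_0,\dots,w_{r-1}))\}$. For $\varphi\in Fm_k$ and terms $t_0,\dots,t_k$ of sorts $S_0,\dots,S_k$ (variables or constants), $\mathrm{ST}^k_{t_0,\dots,t_k}(\varphi)$ is defined by: - $\mathrm{ST}^k_{t_0,\dots,t_k}(\beta)=\mathrm{ST}^{k-1}_{t_0,\dots,t_{k-1}}(\beta)$ for $\beta\in B_{k-1}$; - $\mathrm{ST}^k_{t_0,\dots,t_k}(p_k)=p_k(t_0,\dots,t_k)$; - $\mathrm{ST}^k_{t_0,\dots,t_k}(i_k)=(i_k=t_k)$; - $\mathrm{ST}^k_{t_0,\dots,t_k}(@_{i_k}\varphi)=D_k(t_0,\dots,t_{k-1},i_k)\wedge\mathrm{ST}^k_{t_0,\dots,t_{k-1},i_k}(\varphi)$; - $\mathrm{ST}^k_{t_0,\dots,t_k}(\Diamond_k\varphi)=\exists y_0\cdots\exists y_k\big(D_k(y_0,\dots,y_k)\wedge R_k(t_0,\dots,t_k,y_0,\dots,y_k)\wedge\mathrm{ST}^k_{y_0,\dots,y_k}(\varphi)\big)$ with fresh variables $y_r$ of sort $S_r$; - $\mathrm{ST}^k(\varphi\wedge\psi)=\mathrm{ST}^k(\varphi)\wedge\mathrm{ST}^k(\psi)$, $\mathrm{ST}^k(\neg\varphi)=\neg\mathrm{ST}^k(\varphi)$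 (same subscripts). -}

module Defs where

open import Data.Nat using (ℕ; zero; suc)
open import Data.Product using (Σ; _×_; _,_; proj₁; proj₂)
open import Data.List using (List; []; _∷_)
open import Data.List.Membership.Propositional using (_∈_)
open import Data.List.Relation.Unary.Any using (here; there)
open import Data.List.Relation.Unary.All using (All; []; _∷_; lookup)
open import Relation.Binary.PropositionalEquality using (_≡_; refl; trans; cong)
open import Relation.Nullary using (¬_)

TupF : (ℕ → Set) → ℕ → Set
TupF G zero    = G zero
TupF G (suc k) = TupF G k × G (suc k)

lastT : ∀ {G} k → TupF G k → G k
lastT zero    s       = s
lastT (suc k) (t , w) = w

replT : ∀ {G} k → TupF G k → G k → TupF G k
replT zero    s       v = v
replT (suc k) (t , w) v = (t , v)

mapT : ∀ {F G : ℕ → Set} k → (∀ {r} → F r → G r) → TupF F k → TupF G k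
mapT zero    f s       = f s
mapT (suc k) f (t , w) = (mapT k f t , f w)

-- k ≤ m, in the form used for restricting tuples
data _≼_ (k : ℕ) : ℕ → Set where
  ≼-refl : k ≼ k
  ≼-step : ∀ {m} → k ≼ m → k ≼ suc m

≼-pred : ∀ {k m} → suc k ≼ m → k ≼ m
≼-pred ≼-refl     = ≼-step ≼-refl
≼-pred (≼-step p) = ≼-step (≼-pred p)

restr : ∀ {G k m} → k ≼ m → TupF G m → TupF G k
restr ≼-refl     s       = s
restr (≼-step p) (s , _) = restr p s

restr-pred : ∀ {G k m} (p : suc k ≼ m) (s : TupF G m) →
             restr (≼-pred p) s ≡ proj₁ (restr p s)
restr-pred ≼-refl     s       = refl
restr-pred (≼-step p) (s , _) = restr-pred p s

-- Layered signatures (levels indexed by ℕ; only levels 0..n are used)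

record LSig : Set₁ where
  field
    PropSym : ℕ → Set
    NomSym  : ℕ → Set
open LSig public

-- Formulas Fm_k and basic formulas B_k (B_k ⊆ Fm_k as a predicate)

module Formulas (S : LSig) where
  data Fm : ℕ → Set
  data Basic : ∀ {k} → Fm k → Set

  data Fm where
    base : ∀ {k} (β : Fm k) → Basic β → Fm (suc k)
    nom  : ∀ {k} → NomSym S k → Fm k
    prop : ∀ {k} → PropSym S k → Fm k
    neg  : ∀ {k} → Fm k → Fm k
    and  : ∀ {k} → Fm k → Fm k → Fm k
    at   : ∀ {k} → NomSym S k → Fm k → Fm k
    dia  : ∀ {k} → Fm k → Fm k

  data Basic where
    b-nom  : ∀ {k} (i : NomSym S k) → Basic (nom i)
    b-prop : ∀ {k} (p : PropSym S k) → Basic (prop p)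
    b-base : ∀ {k} {β : Fm k} (b : Basic β) → Basic (base β b)
    b-at   : ∀ {k} (i : NomSym S k) (φ : Fm k) → Basic (at i φ)
    b-dia  : ∀ {k} (φ : Fm k) → Basic (dia φ)
open Formulas public

Dk : (W : ℕ → Set) (n : ℕ) (D : TupF W n → Set) (k : ℕ) → TupF W k → Set
Dk W n D k t = Σ (TupF W n) λ s → D s × Σ (k ≼ n) λ p → restr p s ≡ t

prefixD : ∀ {W n D k t w} → Dk W n D (suc k) (t , w) → Dk W n D k t
prefixD (s , Ds , p , eq) = s , Ds , ≼-pred p , trans (restr-pred p s) (cong proj₁ eq)

Covered : (W : ℕ → Set) (n : ℕ) (D : TupF W n → Set) (k : ℕ) → W k → Set
Covered W n D zero    v = Dk W n D zero v
Covered W n D (suc k) v =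
  Σ (TupF W k) λ t → Dk W n D k t × Dk W n D (suc k) (t , v)

record Model (S : LSig) (n : ℕ) : Set₁ where
  field
    W      : ℕ → Set
    D      : TupF W n → Set
    W-def  : ∀ k → k ≼ n → (v : W k) → Covered W n D k v
    R      : (k : ℕ) → TupF W k → TupF W k → Set
    R⊆D    : ∀ {k t v} → R k t v → Dk W n D k t × Dk W n D k v
    VNom   : (k : ℕ) → NomSym S k → W k
    VProp0 : PropSym S zero → W zero → Set
    VProp  : (k : ℕ) → PropSym S (suc k) → (t : TupF W k) → .(Dk W n D k t) → W (suc k) → Set
open Model public

DM : ∀ {S n} (M : Model S n) (k : ℕ) → TupF (W M) k → Set
DM {S} {n} M = Dk (W M) n (D M)

module _ {S : LSig} {n : ℕ} (M : Model S n) where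
  satProp : ∀ k → PropSym S k → (t : TupF (W M) k) → .(DM M k t) → Set
  satProp zero    p w       d = VProp0 M p w
  satProp (suc k) p (t , w) d = VProp M k p t (prefixD d) w

  sat : ∀ k → Fm S k → (t : TupF (W M) k) → .(DM M k t) → Set
  sat (suc k) (base β b) (t , w) d = sat k β t (prefixD d)
  sat k (nom i)   t d = (lastT k t ≡ VNom M k i) × DM M k (replT k t (VNom M k i))
  sat k (prop p)  t d = satProp k p t d
  sat k (neg φ)   t d = ¬ sat k φ t d
  sat k (and φ ψ) t d = sat k φ t d × sat k ψ t d
  sat k (at i φ)  t d =
    Σ (DM M k (replT k t (VNom M k i))) λ e → sat k φ (replT k t (VNom M k i)) e
  sat k (dia φ)   t d =
    Σ (TupF (W M) k) λ v → Σ (R M k t v) λ r → sat k φ v (proj₂ (R⊆D M r))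

record FOSig : Set₁ where
  field
    Sort  : Set
    Con   : Sort → Set
    Rel   : Set
    arity : Rel → List Sort
open FOSig public

module FO (Σ' : FOSig) where
  Ctx : Set
  Ctx = List (Sort Σ')

  data Term (Γ : Ctx) (s : Sort Σ') : Set where
    var : s ∈ Γ → Term Γ s
    con : Con Σ' s → Term Γ s

  data Formula (Γ : Ctx) : Set where
    _≐_ : ∀ {s} → Term Γ s → Term Γ s → Formula Γ
    rel : (ρ : Rel Σ') → All (Term Γ) (arity Σ' ρ) → Formula Γ
    ¬'  : Formula Γ → Formula Γ
    _∧'_ : Formula Γ → Formula Γ → Formula Γ
    ∃'  : (s : Sort Σ') → Formula (s ∷ Γ) → Formula Γ

  record Structure : Set₁ where
    field
      carrier : Sort Σ' → Set
      conI    : ∀ {s} → Con Σ' s → carrier s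
      relI    : (ρ : Rel Σ') → All carrier (arity Σ' ρ) → Set
  open Structure public

  eval : ∀ {Γ s} (𝔐 : Structure) → All (carrier 𝔐) Γ → Term Γ s → carrier 𝔐 s
  eval 𝔐 a (var x) = lookup a x
  eval 𝔐 a (con c) = conI 𝔐 c

  evalAll : ∀ {Γ ss} (𝔐 : Structure) → All (carrier 𝔐) Γ → All (Term Γ) ss → All (carrier 𝔐) ss
  evalAll 𝔐 a []       = []
  evalAll 𝔐 a (t ∷ ts) = eval 𝔐 a t ∷ evalAll 𝔐 a ts

  _⊨_[_] : ∀ {Γ} (𝔐 : Structure) → Formula Γ → All (carrier 𝔐) Γ → Set
  𝔐 ⊨ (t ≐ u)  [ a ] = eval 𝔐 a t ≡ eval 𝔐 a u
  𝔐 ⊨ rel ρ ts [ a ] = relI 𝔐 ρ (evalAll 𝔐 a ts)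
  𝔐 ⊨ ¬' φ     [ a ] = ¬ (𝔐 ⊨ φ [ a ])
  𝔐 ⊨ (φ ∧' ψ) [ a ] = (𝔐 ⊨ φ [ a ]) × (𝔐 ⊨ ψ [ a ])
  𝔐 ⊨ ∃' s φ   [ a ] = Σ (carrier 𝔐 s) λ v → 𝔐 ⊨ φ [ v ∷ a ]

-- Argument lists S_0 ⋯ S_r (followed by rest) and their tuple encoding

ss' : ℕ → List ℕ → List ℕ
ss' zero    rest = zero ∷ rest
ss' (suc r) rest = ss' r (suc r ∷ rest)

ss : ℕ → List ℕ
ss r = ss' r []

toAll : ∀ {G : ℕ → Set} {rest} r → TupF G r → All G rest → All G (ss' r rest)
toAll zero    w       a = w ∷ a
toAll (suc r) (t , w) a = toAll r t (w ∷ a)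

fromAll : ∀ {G : ℕ → Set} {rest} r → All G (ss' r rest) → TupF G r × All G rest
fromAll zero    (w ∷ a) = w , a
fromAll {G} {rest} (suc r) as = step (fromAll r as)
  where
  step : TupF G r × All G (suc r ∷ rest) → TupF G (suc r) × All G rest
  step (t , (w ∷ a)) = (t , w) , a

-- The first-order signature Σ (sorts S_r = r; Σ^k is its level-≤k part)

data RelSym (S : LSig) : Set where
  Dsym : ℕ → RelSym S
  Psym : (r : ℕ) → PropSym S r → RelSym S
  Rsym : ℕ → RelSym S

ΣFO : LSig → FOSig
ΣFO S = record
  { Sort  = ℕ
  ; Con   = NomSym S
  ; Rel   = RelSym S
  ; arity = ar
  }
  where
  ar : RelSym S → List ℕ
  ar (Dsym r)   = ss r
  ar (Psym r p) = ss r
  ar (Rsym r)   = ss' r (ss r)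

module _ {S : LSig} {n : ℕ} (M : Model S n) where
  open FO (ΣFO S)

  PI : ∀ r → PropSym S r → TupF (W M) r → Set
  PI zero    p w       = VProp0 M p w
  PI (suc r) p (t , w) = Σ (DM M r t) λ d → VProp M r p t d w

  Mstar : Structure
  Mstar = record
    { carrier = W M
    ; conI    = λ {s} i → VNom M s i
    ; relI    = I
    }
    where
    I : (ρ : RelSym S) → All (W M) (arity (ΣFO S) ρ) → Set
    I (Dsym r)   as = DM M r (proj₁ (fromAll r as))
    I (Psym r p) as = PI r p (proj₁ (fromAll r as))
    I (Rsym r)   as = R M r (proj₁ (fromAll r as)) (proj₁ (fromAll r (proj₂ (fromAll r as))))

-- context extended by y_0 : S_0 , … , y_k : S_k  (y_k innermost)
ext : ℕ → List ℕ → List ℕ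
ext zero    Γ = zero ∷ Γ
ext (suc k) Γ = suc k ∷ ext k Γ

asg : ∀ {G : ℕ → Set} {Γ} k → TupF G k → All G Γ → All G (ext k Γ)
asg zero    w       a = w ∷ a
asg (suc k) (t , w) a = w ∷ asg k t a

module _ (S : LSig) where
  open FO (ΣFO S)

  TermTup : Ctx → ℕ → Set
  TermTup Γ k = TupF (Term Γ) k

  wk : ∀ {Γ x s} → Term Γ s → Term (x ∷ Γ) s
  wk (var m) = var (there m)
  wk (con c) = con c

  wkExt : ∀ {Γ s} k → Term Γ s → Term (ext k Γ) s
  wkExt zero    t = wk t
  wkExt (suc k) t = wk (wkExt k t)

  vars : ∀ {Γ} k → TermTup (ext k Γ) k
  vars zero    = var (here refl)
  vars (suc k) = mapT k wk (vars k) , var (here refl)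

  exs : ∀ {Γ} k → Formula (ext k Γ) → Formula Γ
  exs zero    φ = ∃' zero φ
  exs (suc k) φ = exs k (∃' (suc k) φ)

  ST : ∀ {Γ} k → Fm S k → TermTup Γ k → Formula Γ
  ST (suc k) (base β b) (ts , t) = ST k β ts
  ST k (prop p)  ts = rel (Psym k p) (toAll k ts [])
  ST k (nom i)   ts = con i ≐ lastT k ts
  ST k (at i φ)  ts =
    rel (Dsym k) (toAll k (replT k ts (con i)) []) ∧' ST k φ (replT k ts (con i))
  ST {Γ} k (dia φ) ts =
    exs k (  rel (Dsym k) (toAll k ys [])
          ∧' (rel (Rsym k) (toAll k (mapT k (wkExt k) ts) (toAll k ys []))
          ∧' ST k φ ys))
    where ys = vars {Γ} k
  ST k (and φ ψ) ts = ST k φ ts ∧' ST k ψ ts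
  ST k (neg φ)   ts = ¬' (ST k φ ts)

-- Induction on φ, generalised from the variables x_0 … x_k to an arbitrary tuple of
-- terms ts under an assignment a whose values are (w_0, …, w_k): the @_i case replaces
-- the last term by the constant i, and the ◇ case passes to the fresh variables
-- y_0 … y_k under the extended assignment.  The atomic cases hold because M* reads
-- D_r, p_r and R_r off the decoded argument tuples, which are exactly the values of ts.
module Submission where

open import Defs
open import Data.Nat using (ℕ; _≤_; zero; suc)
open import Data.List using ([]; _∷_)
open import Data.List.Relation.Unary.All using ([]; All; _∷_)
open import Data.Product using (Σ; _×_; _,_; proj₁; proj₂)
open import Data.Product.Function.NonDependent.Propositional using (_×-⇔_)
open import Function.Base using (_∘_; id)
open import Function.Bundles using (_⇔_; mk⇔; Equivalence)
open import Function.Construct.Composition using (_⇔-∘_)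
open import Function.Construct.Symmetry using (⇔-sym)
open import Function.Related.Propositional using (≡⇒; equivalence; module EquationalReasoning)
open import Function.Related.TypeIsomorphisms using (¬-cong-⇔)
open import Relation.Binary.PropositionalEquality
  using (_≡_; refl; sym; trans; cong; cong₂; subst)

open Equivalence using (to; from)

private
  variable
    A C E : Set
    B : A → Set
    F G H : ℕ → Set

Σ-cong-⇔ : {C : A → Set} → (∀ x → B x ⇔ C x) → Σ A B ⇔ Σ A C
Σ-cong-⇔ B⇔C = mk⇔ (λ (x , b) → x , to (B⇔C x) b) (λ (x , c) → x , from (B⇔C x) c)

Σ-⇔-× : (A⇔C : A ⇔ C) → (∀ x → B x ⇔ E) → Σ A B ⇔ (C × E)
Σ-⇔-× A⇔C B⇔E =
  mk⇔ (λ (x , b) → to A⇔C x , to (B⇔E x) b)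
      (λ (c , e) → from A⇔C c , from (B⇔E (from A⇔C c)) e)

≡-sym-⇔ : {x y : A} → (x ≡ y) ⇔ (y ≡ x)
≡-sym-⇔ = mk⇔ sym sym

⇔-×-implied : (A → C) → A ⇔ (C × A)
⇔-×-implied f = mk⇔ (λ x → f x , x) proj₂

mapT-fusion : ∀ k {f : ∀ {r} → G r → H r} {g : ∀ {r} → F r → G r} {h : ∀ {r} → F r → H r} →
              (∀ {r} (x : F r) → f (g x) ≡ h x) →
              (t : TupF F k) → mapT k f (mapT k g t) ≡ mapT k h t
mapT-fusion zero    fg≗h t       = fg≗h t
mapT-fusion (suc k) fg≗h (t , w) = cong₂ _,_ (mapT-fusion k fg≗h t) (fg≗h w)

lastT-mapT : ∀ k (f : ∀ {r} → F r → G r) (t : TupF F k) → lastT k (mapT k f t) ≡ f (lastT k t)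
lastT-mapT zero    f t       = refl
lastT-mapT (suc k) f (t , w) = refl

replT-mapT : ∀ k (f : ∀ {r} → F r → G r) (t : TupF F k) (x : F k) →
             mapT k f (replT k t x) ≡ replT k (mapT k f t) (f x)
replT-mapT zero    f t       x = refl
replT-mapT (suc k) f (t , w) x = refl

replT-lastT : ∀ k (t : TupF G k) → replT k t (lastT k t) ≡ t
replT-lastT zero    t       = refl
replT-lastT (suc k) (t , w) = refl

lastT≡-replT⇔ : ∀ k (P : TupF G k → Set) {t : TupF G k} {x : G k} → P t →
                (lastT k t ≡ x × P (replT k t x)) ⇔ (lastT k t ≡ x)
lastT≡-replT⇔ k P {t} p = mk⇔ proj₁ λ e →
  e , subst (P ∘ replT k t) e (subst P (sym (replT-lastT k t)) p)

fromAll-toAll : ∀ {rest} r (t : TupF G r) (as : All G rest) → fromAll r (toAll r t as) ≡ (t , as)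
fromAll-toAll zero    t       as = refl
fromAll-toAll (suc r) (t , w) as rewrite fromAll-toAll r t (w ∷ as) = refl

module Semantics {S : LSig} where
  open FO (ΣFO S)

  module _ (𝔐 : Structure) where

    evalTup : ∀ {Γ} k → All (carrier 𝔐) Γ → TermTup S Γ k → TupF (carrier 𝔐) k
    evalTup k a = mapT k (eval 𝔐 a)

    evalAll-toAll : ∀ {Γ rest} (a : All (carrier 𝔐) Γ) r (ts : TermTup S Γ r) (us : All (Term Γ) rest) →
                    evalAll 𝔐 a (toAll r ts us) ≡ toAll r (evalTup r a ts) (evalAll 𝔐 a us)
    evalAll-toAll a zero    ts       us = refl
    evalAll-toAll a (suc r) (ts , t) us = evalAll-toAll a r ts (t ∷ us)

    fromAll-evalAll : ∀ {Γ rest} (a : All (carrier 𝔐) Γ) r (ts : TermTup S Γ r) (us : All (Term Γ) rest) →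
                      fromAll r (evalAll 𝔐 a (toAll r ts us)) ≡ (evalTup r a ts , evalAll 𝔐 a us)
    fromAll-evalAll a r ts us rewrite evalAll-toAll a r ts us = fromAll-toAll r _ _

    eval-wk : ∀ {Γ s x} (v : carrier 𝔐 x) (a : All (carrier 𝔐) Γ) (t : Term Γ s) →
              eval 𝔐 (v ∷ a) (wk S t) ≡ eval 𝔐 a t
    eval-wk v a (var m) = refl
    eval-wk v a (con c) = refl

    eval-wkExt : ∀ {Γ s} k (v : TupF (carrier 𝔐) k) (a : All (carrier 𝔐) Γ) (t : Term Γ s) →
                 eval 𝔐 (asg k v a) (wkExt S k t) ≡ eval 𝔐 a t
    eval-wkExt zero    v       a t = eval-wk v a t
    eval-wkExt (suc k) (v , w) a t = trans (eval-wk w (asg k v a) (wkExt S k t)) (eval-wkExt k v a t)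

    evalTup-wkExt : ∀ {Γ} k (v : TupF (carrier 𝔐) k) (a : All (carrier 𝔐) Γ) (ts : TermTup S Γ k) →
                    evalTup k (asg k v a) (mapT k (wkExt S k) ts) ≡ evalTup k a ts
    evalTup-wkExt k v a = mapT-fusion k (eval-wkExt k v a)

    evalTup-vars : ∀ {Γ} k (v : TupF (carrier 𝔐) k) (a : All (carrier 𝔐) Γ) →
                   evalTup k (asg k v a) (vars S {Γ} k) ≡ v
    evalTup-vars zero    v       a = refl
    evalTup-vars (suc k) (v , w) a =
      cong (_, w) (trans (mapT-fusion k (eval-wk w (asg k v a)) (vars S k)) (evalTup-vars k v a))

    ⊨-exs : ∀ {Γ} k (ψ : Formula (ext k Γ)) (a : All (carrier 𝔐) Γ) →
            𝔐 ⊨ exs S k ψ [ a ] ⇔ Σ (TupF (carrier 𝔐) k) λ v → 𝔐 ⊨ ψ [ asg k v a ]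
    ⊨-exs zero    ψ a = mk⇔ id id
    ⊨-exs (suc k) ψ a =
      mk⇔ (λ (v , w , p) → (v , w) , p) (λ ((v , w) , p) → v , w , p) ⇔-∘ ⊨-exs k (∃' (suc k) ψ) a

module Translation {S : LSig} {n : ℕ} (M : Model S n) where
  open FO (ΣFO S)
  open Semantics {S}
  open EquationalReasoning {k = equivalence}

  M* : Structure
  M* = Mstar M

  ⊨-D : ∀ {Γ} (a : All (W M) Γ) r (ts : TermTup S Γ r) →
        (M* ⊨ rel (Dsym r) (toAll r ts []) [ a ]) ≡ DM M r (evalTup M* r a ts)
  ⊨-D a r ts = cong (DM M r ∘ proj₁) (fromAll-evalAll M* a r ts [])

  ⊨-P : ∀ {Γ} (a : All (W M) Γ) r p (ts : TermTup S Γ r) →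
        (M* ⊨ rel (Psym r p) (toAll r ts []) [ a ]) ≡ PI M r p (evalTup M* r a ts)
  ⊨-P a r p ts = cong (PI M r p ∘ proj₁) (fromAll-evalAll M* a r ts [])

  ⊨-R : ∀ {Γ} (a : All (W M) Γ) r (ts us : TermTup S Γ r) →
        (M* ⊨ rel (Rsym r) (toAll r ts (toAll r us [])) [ a ]) ≡
        R M r (evalTup M* r a ts) (evalTup M* r a us)
  ⊨-R a r ts us
    rewrite fromAll-evalAll M* a r ts (toAll r us []) | fromAll-evalAll M* a r us [] = refl

  nom⇔ : ∀ {Γ} k i (ts : TermTup S Γ k) (a : All (W M) Γ) → DM M k (evalTup M* k a ts) →
         (lastT k (evalTup M* k a ts) ≡ VNom M k i × DM M k (replT k (evalTup M* k a ts) (VNom M k i)))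
         ⇔ (VNom M k i ≡ eval M* a (lastT k ts))
  nom⇔ k i ts a d =
    begin
      (lastT k w ≡ VNom M k i × DM M k (replT k w (VNom M k i)))
    ∼⟨ lastT≡-replT⇔ k (DM M k) d ⟩
      lastT k w ≡ VNom M k i
    ≡⟨ cong (_≡ VNom M k i) (lastT-mapT k (eval M* a) ts) ⟩
      eval M* a (lastT k ts) ≡ VNom M k i
    ∼⟨ ≡-sym-⇔ ⟩
      VNom M k i ≡ eval M* a (lastT k ts)
    ∎
    where w = evalTup M* k a ts

  ST-correct : ∀ {Γ} k → Fm S k → TermTup S Γ k → All (W M) Γ → Set
  ST-correct k φ ts a = ∀ {w} (d : DM M k w) → evalTup M* k a ts ≡ w → sat M k φ w d ⇔ M* ⊨ ST S k φ ts [ a ]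

  at⇔ : ∀ {Γ} k i φ (ts : TermTup S Γ k) (a : All (W M) Γ) →
        ST-correct k φ (replT k ts (con i)) a →
        (Σ (DM M k (replT k (evalTup M* k a ts) (VNom M k i))) λ e →
           sat M k φ (replT k (evalTup M* k a ts) (VNom M k i)) e)
        ⇔ (M* ⊨ rel (Dsym k) (toAll k (replT k ts (con i)) []) [ a ] × M* ⊨ ST S k φ (replT k ts (con i)) [ a ])
  at⇔ k i φ ts a ih = Σ-⇔-× (≡⇒ (sym (trans (⊨-D a k ts′) (cong (DM M k) ts′-value))))
                            (λ e → ih e ts′-value)
    where
    ts′ = replT k ts (con i)
    ts′-value : evalTup M* k a ts′ ≡ replT k (evalTup M* k a ts) (VNom M k i)
    ts′-value = replT-mapT k (eval M* a) ts (con i)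

  dia⇔ : ∀ {Γ} k φ (ts : TermTup S Γ k) (a : All (W M) Γ) →
         (∀ v → ST-correct k φ (vars S {Γ} k) (asg k v a)) →
         (Σ (TupF (W M) k) λ v → Σ (R M k (evalTup M* k a ts) v) λ r → sat M k φ v (proj₂ (R⊆D M r)))
         ⇔ (M* ⊨ exs S k (rel (Dsym k) (toAll k (vars S {Γ} k) [])
                          ∧' (rel (Rsym k) (toAll k (mapT k (wkExt S k) ts) (toAll k (vars S {Γ} k) []))
                          ∧' ST S k φ (vars S {Γ} k))) [ a ])
  dia⇔ {Γ} k φ ts a ih = ⇔-sym (⊨-exs M* k _ a) ⇔-∘ Σ-cong-⇔ at-successor
    where
    ys = vars S {Γ} k
    at-successor : ∀ v → (Σ (R M k (evalTup M* k a ts) v) λ r → sat M k φ v (proj₂ (R⊆D M r)))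
                   ⇔ (M* ⊨ rel (Dsym k) (toAll k ys []) [ asg k v a ] ×
                      (M* ⊨ rel (Rsym k) (toAll k (mapT k (wkExt S k) ts) (toAll k ys [])) [ asg k v a ] ×
                       M* ⊨ ST S k φ ys [ asg k v a ]))
    at-successor v =
      (≡⇒ (sym D-value) ×-⇔ Σ-⇔-× (≡⇒ (sym R-value)) (λ r → ih v (proj₂ (R⊆D M r)) ys-value))
      ⇔-∘ ⇔-×-implied (proj₂ ∘ R⊆D M ∘ proj₁)
      where
      ys-value = evalTup-vars M* k v a
      D-value = trans (⊨-D (asg k v a) k ys) (cong (DM M k) ys-value)
      R-value = trans (⊨-R (asg k v a) k (mapT k (wkExt S k) ts) ys)
                      (cong₂ (R M k) (evalTup-wkExt M* k v a ts) ys-value)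

  -- sat and ST match on suc k in their base clause, so their other clauses compute
  -- only once k is a constructor; hence each connective is split into zero and suc k.
  sat⇔⊨ST : ∀ {Γ} k φ (ts : TermTup S Γ k) (a : All (W M) Γ) → ST-correct k φ ts a
  sat⇔⊨ST (suc k) (base β b) (ts , _) a d refl = sat⇔⊨ST k β ts a (prefixD d) refl
  sat⇔⊨ST zero    (nom i)    ts a d refl = nom⇔ zero i ts a d
  sat⇔⊨ST (suc k) (nom i)    ts a d refl = nom⇔ (suc k) i ts a d
  sat⇔⊨ST zero    (prop p)   ts a d refl = ≡⇒ (sym (⊨-P a zero p ts))
  sat⇔⊨ST (suc k) (prop p)   ts a d refl =
    -- VProp ignores its irrelevant D_k-witness, so PI is a plain product with DM.
    ≡⇒ (sym (⊨-P a (suc k) p ts)) ⇔-∘ ⇔-×-implied (λ _ → prefixD d)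
  sat⇔⊨ST zero    (neg φ)    ts a d refl = ¬-cong-⇔ (sat⇔⊨ST zero φ ts a d refl)
  sat⇔⊨ST (suc k) (neg φ)    ts a d refl = ¬-cong-⇔ (sat⇔⊨ST (suc k) φ ts a d refl)
  sat⇔⊨ST zero    (and φ ψ)  ts a d refl = sat⇔⊨ST zero φ ts a d refl ×-⇔ sat⇔⊨ST zero ψ ts a d refl
  sat⇔⊨ST (suc k) (and φ ψ)  ts a d refl = sat⇔⊨ST (suc k) φ ts a d refl ×-⇔ sat⇔⊨ST (suc k) ψ ts a d refl
  sat⇔⊨ST zero    (at i φ)   ts a d refl = at⇔ zero i φ ts a (sat⇔⊨ST zero φ _ a)
  sat⇔⊨ST (suc k) (at i φ)   ts a d refl = at⇔ (suc k) i φ ts a (sat⇔⊨ST (suc k) φ _ a)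
  sat⇔⊨ST zero    (dia φ)    ts a d refl = dia⇔ zero φ ts a (λ _ → sat⇔⊨ST zero φ _ _)
  sat⇔⊨ST (suc k) (dia φ)    ts a d refl = dia⇔ (suc k) φ ts a (λ _ → sat⇔⊨ST (suc k) φ _ _)

theorem1 : (S : LSig) (n : ℕ) (M : Model S n) (k : ℕ) → k ≤ n →
           (φ : Fm S k) (w : TupF (W M) k) (d : DM M k w) →
           sat M k φ w d ⇔ FO._⊨_[_] (ΣFO S) (Mstar M) (ST S {ext k []} k φ (vars S {[]} k)) (asg k w [])
theorem1 S n M k _ φ w d =
  Translation.sat⇔⊨ST M k φ (vars S k) (asg k w []) d (Semantics.evalTup-vars (Mstar M) k w [])
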